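{- Let $R$ be an integral domain with $\operatorname{char} R\neq 2$, and let $\mathcal{A}$ be a central real hyperplane arrangement that is generic in codimension $2$. Then $$\mathrm{Heav}(\mathcal{A})=\bigl(\mathrm{Fil}^1\mathrm{VG}(\mathcal{A})_R\cap\mathrm{Idem}(\mathrm{VG}(\mathcal{A})_R)\bigr)\setminus\{0,1\}.$$
   Context: $\mathcal{A}=\{H_1,\dots,H_n\}$ is a finite set of distinct linear hyperplanes in $\mathbb{R}^\ell$, $H_i=\alpha_i^{ -1}(0)$, $H_i^\pm$ the open half-spaces $\pm\alpha_i>0$. Chambers are the connected components of the complement of $\bigcup H_i$. $\mathrm{VG}(\mathcal{A})_R$ is the $R$-algebra of all functions from chambers to $R$ (pointwise operations); $\mathrm{Idem}$ denotes its set of idempotents ($f^2=f$). $x_i^\pm$ is the indicator function of chambers contained in $H_i^\pm$, and $\mathrm{Heav}(\mathcal{A})=\{x_i^\pm\mid 1\le i\le n\}$. $\mathrm{Fil}^1\mathrm{VG}(\mathcal{A})_R$ is the $R$-span of $1,x_1^+,\dots,x_n^+$. $\mathcal{A}$ is generic in codimension $2$ if every codimension-$2$ intersection of hyperplanes of $\mathcal{A}$ is contained in exactly two hyperplanes of $\mathcal{A}$. -}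

module Defs where

open import Level using (Level; _⊔_) renaming (suc to lsuc)
open import Data.Nat using (ℕ; zero; suc)
open import Data.Fin using (Fin; zero; suc)
open import Data.Bool using (Bool; true; false; if_then_else_)
open import Data.Product using (Σ; ∃; _×_; _,_)
open import Data.Sum using (_⊎_)
open import Relation.Nullary using (¬_)
open import Relation.Binary.Structures using (IsStrictTotalOrder)
open import Relation.Binary.PropositionalEquality using (_≡_)
open import Algebra.Bundles using (CommutativeRing)
open import Function.Bundles using (_⇔_)

-- The real numbers, axiomatised as a Dedekind-complete ordered field
-- (the unique such field up to isomorphism is ℝ).

record RealField (c ℓ₁ ℓ₂ : Level) : Set (lsuc (c ⊔ ℓ₁ ⊔ ℓ₂)) where
  field
    commRing : CommutativeRing c ℓ₁
  open CommutativeRing commRing public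
    using (Carrier; _≈_; _+_; _*_; -_; 0#; 1#)
  infix 4 _<_ _≤_
  field
    _<_ : Carrier → Carrier → Set ℓ₂
    <-isStrictTotalOrder : IsStrictTotalOrder _≈_ _<_
    +-monoˡ-< : ∀ {a b} d → a < b → a + d < b + d
    *-pos : ∀ {a b} → 0# < a → 0# < b → 0# < a * b
    0<1 : 0# < 1#
    inverse : ∀ a → ¬ (a ≈ 0#) → Σ Carrier (λ b → a * b ≈ 1#)
  _≤_ : Carrier → Carrier → Set ℓ₂
  a ≤ b = ¬ (b < a)
  field
    lub : (P : Carrier → Set (c ⊔ ℓ₁ ⊔ ℓ₂)) →
          Σ Carrier P →
          Σ Carrier (λ b → ∀ x → P x → x ≤ b) →
          Σ Carrier (λ s → (∀ x → P x → x ≤ s) ×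
                           (∀ b → (∀ x → P x → x ≤ b) → s ≤ b))

module _ {r ℓ : Level} (R : CommutativeRing r ℓ) where
  private module R = CommutativeRing R

  sumFin : (n : ℕ) → (Fin n → R.Carrier) → R.Carrier
  sumFin zero    f = R.0#
  sumFin (suc n) f = f zero R.+ sumFin n (λ i → f (suc i))

module _ {c ℓ₁ ℓ₂ : Level} (𝕂 : RealField c ℓ₁ ℓ₂) where
  open RealField 𝕂

  Point : ℕ → Set c
  Point ℓ = Fin ℓ → Carrier

  eval : {ℓ : ℕ} → (Fin ℓ → Carrier) → Point ℓ → Carrier
  eval {ℓ} a x = sumFin commRing ℓ (λ j → a j * x j)

  record Arrangement : Set (c ⊔ ℓ₁) where
    field
      dim : ℕ
      n   : ℕ
      α   : Fin n → Fin dim → Carrier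
      nonzero  : ∀ i → Σ (Point dim) (λ x → ¬ (eval (α i) x ≈ 0#))
      distinct : ∀ i j → ¬ (i ≡ j) →
                 ¬ (∀ x → (eval (α i) x ≈ 0# → eval (α j) x ≈ 0#) ×
                          (eval (α j) x ≈ 0# → eval (α i) x ≈ 0#))

  module _ (A : Arrangement) where
    open Arrangement A

    OnH : Fin n → Point dim → Set ℓ₁
    OnH i x = eval (α i) x ≈ 0#

    InHalf : Bool → Fin n → Point dim → Set ℓ₂
    InHalf true  i x = 0# < eval (α i) x
    InHalf false i x = eval (α i) x < 0#

    -- Chambers: the connected components of the complement are the open
    -- convex cones {x | sign α_i(x) = s_i ∀ i} for realised sign vectors s.
    SignVec : Set
    SignVec = Fin n → Bool

    IsChamber : SignVec → Set (c ⊔ ℓ₂)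
    IsChamber s = Σ (Point dim) (λ x → ∀ i → InHalf (s i) i x)

    GenericCodim2 : Set (c ⊔ ℓ₁)
    GenericCodim2 = ∀ i j → ¬ (i ≡ j) → ∀ k →
      (∀ x → OnH i x → OnH j x → OnH k x) → (k ≡ i) ⊎ (k ≡ j)

    -- The algebra VG(A)_R of functions on chambers with values in R.
    -- Elements are represented as functions on sign vectors; two elements
    -- are equal iff they agree on all chambers.

    module _ {r ℓr : Level} (R : CommutativeRing r ℓr) where
      private module R = CommutativeRing R

      VG : Set r
      VG = SignVec → R.Carrier

      infix 4 _≈V_
      _≈V_ : VG → VG → Set (c ⊔ ℓ₂ ⊔ ℓr)
      f ≈V g = ∀ s → IsChamber s → f s R.≈ g s

      0V 1V : VG
      0V s = R.0#
      1V s = R.1#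

      _*V_ : VG → VG → VG
      (f *V g) s = f s R.* g s

      x : Bool → Fin n → VG
      x true  i s = if s i then R.1# else R.0#
      x false i s = if s i then R.0# else R.1#

      InHeav : VG → Set (c ⊔ ℓ₂ ⊔ ℓr)
      InHeav f = Σ Bool (λ σ → Σ (Fin n) (λ i → f ≈V x σ i))

      InFil1 : VG → Set (c ⊔ ℓ₂ ⊔ r ⊔ ℓr)
      InFil1 f = Σ R.Carrier (λ c₀ → Σ (Fin n → R.Carrier) (λ cs →
                   f ≈V (λ s → c₀ R.+ sumFin R n (λ i → cs i R.* x true i s))))

      IsIdem : VG → Set (c ⊔ ℓ₂ ⊔ ℓr)
      IsIdem f = (f *V f) ≈V f

module _ {r ℓ : Level} (R : CommutativeRing r ℓ) where
  open CommutativeRing R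

  IsIntegralDomain : Set (r ⊔ ℓ)
  IsIntegralDomain = ¬ (1# ≈ 0#) × (∀ a b → a * b ≈ 0# → (a ≈ 0#) ⊎ (b ≈ 0#))

  CharNot2 : Set ℓ
  CharNot2 = ¬ (1# + 1# ≈ 0#)

{-# OPTIONS --safe #-}
module Submission where

-- Forward: x_i^- = 1 - x_i^+, so Heaviside functions lie in Fil¹; they are {0,1}-valued, and
-- not constant because every hyperplane has chambers on both sides.
--
-- Backward: an idempotent f is {0,1}-valued on chambers. If f = c₀ + Σ c_i x_i^+, crossing
-- H_i between two adjacent chambers changes f by c_i, so c_i is a difference of two values
-- in {0,1}. For i ≠ j, genericity in codimension 2 yields a square of four chambers around
-- H_i ∩ H_j; as 0, 1 and 2 are distinct in R, a nonzero c_i determines the values of f on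
-- both sides of each i-crossing, so f is constant across the j-crossing and c_j = 0. Hence
-- at most one c_i is nonzero, and f is 0, 1, x_i^+ or x_i^-.
--
-- Chambers are produced from generic points p of a flat: pushing p slightly in a direction d
-- keeps the side of p for every hyperplane avoiding p, and takes the side of d for the
-- hyperplanes through p.

open import Defs
open import Level using (Level; _⊔_)
open import Algebra.Bundles using (CommutativeRing)
open import Data.Bool using (Bool; true; false; not; if_then_else_)
open import Data.Bool.Properties using (¬-not) renaming (_≟_ to _≟B_)
open import Data.Empty using (⊥; ⊥-elim)
open import Data.Fin using (Fin; zero; suc; punchIn) renaming (_≟_ to _≟F_)
open import Data.Fin.Properties using (punchInᵢ≢i; all?; ¬∀⟶∃¬)
open import Data.List using (List; []; _∷_; allFin)
open import Data.List.Membership.Propositional.Properties using (∈-allFin)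
open import Data.List.Relation.Unary.All as All using (All; []; _∷_)
open import Data.Nat using (zero; suc)
open import Data.Product using (Σ; _×_; _,_; proj₁; proj₂; swap)
open import Data.Sum using (_⊎_; inj₁; inj₂; [_,_])
open import Data.Vec.Functional using (removeAt)
open import Function using (_∘_; id; const)
open import Function.Bundles using (_⇔_; mk⇔)
open import Relation.Binary.Definitions using (tri<; tri≈; tri>)
open import Relation.Binary.PropositionalEquality as ≡ using (_≡_; _≢_)
open import Relation.Binary.Structures using (IsStrictTotalOrder)
open import Relation.Nullary using (¬_; Dec; yes; no; does; contradiction)
open import Relation.Nullary.Decidable using (decidable-stable; dec-true; dec-false; _⊎-dec_)
open import Relation.Unary using (Decidable)

module SumFin {r ℓ : Level} (R : CommutativeRing r ℓ) where
  open CommutativeRing R hiding (zero)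
  open import Algebra.Properties.CommutativeMonoid.Sum +-commutativeMonoid
    using (sum; sum-cong-≋; sum-replicate-zero; sum-remove; ∑-distrib-+)
  open import Algebra.Properties.Semiring.Sum semiring using (*-distribˡ-sum)
  open import Relation.Binary.Reasoning.Setoid setoid

  sumFin≡sum : ∀ n (f : Fin n → Carrier) → sumFin R n f ≡ sum f
  sumFin≡sum zero    f = ≡.refl
  sumFin≡sum (suc n) f = ≡.cong (f zero +_) (sumFin≡sum n (f ∘ suc))

  sumFin-cong : ∀ n {f g : Fin n → Carrier} → (∀ i → f i ≈ g i) → sumFin R n f ≈ sumFin R n g
  sumFin-cong n {f} {g} f≈g rewrite sumFin≡sum n f | sumFin≡sum n g = sum-cong-≋ f≈g

  sumFin-zero : ∀ n {f : Fin n → Carrier} → (∀ i → f i ≈ 0#) → sumFin R n f ≈ 0#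
  sumFin-zero n {f} f≈0 rewrite sumFin≡sum n f = trans (sum-cong-≋ f≈0) (sum-replicate-zero n)

  sumFin-+ : ∀ n (f g : Fin n → Carrier) →
             sumFin R n (λ i → f i + g i) ≈ sumFin R n f + sumFin R n g
  sumFin-+ n f g
    rewrite sumFin≡sum n (λ i → f i + g i) | sumFin≡sum n f | sumFin≡sum n g = ∑-distrib-+ f g

  sumFin-*ˡ : ∀ n c (f : Fin n → Carrier) → sumFin R n (λ i → c * f i) ≈ c * sumFin R n f
  sumFin-*ˡ n c f
    rewrite sumFin≡sum n (λ i → c * f i) | sumFin≡sum n f = sym (*-distribˡ-sum c f)

  sumFin-remove : ∀ n (f : Fin (suc n) → Carrier) i →
                  sumFin R (suc n) f ≈ f i + sumFin R n (removeAt f i)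
  sumFin-remove n f i
    rewrite sumFin≡sum (suc n) f | sumFin≡sum n (removeAt f i) = sum-remove f

  sumFin-single : ∀ n {f : Fin n → Carrier} i → (∀ j → j ≢ i → f j ≈ 0#) → sumFin R n f ≈ f i
  sumFin-single (suc n) {f} i off = begin
    sumFin R (suc n) f               ≈⟨ sumFin-remove n f i ⟩
    f i + sumFin R n (removeAt f i)  ≈⟨ +-congˡ (sumFin-zero n (λ j → off _ (punchInᵢ≢i i j))) ⟩
    f i + 0#                         ≈⟨ +-identityʳ (f i) ⟩
    f i                              ∎

  sumFin-jump : ∀ n {f g : Fin n → Carrier} i c → (∀ j → j ≢ i → f j ≈ g j) → f i ≈ c + g i →
                sumFin R n f ≈ c + sumFin R n g
  sumFin-jump (suc n) {f} {g} i c off fi≈ = begin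
    sumFin R (suc n) f                     ≈⟨ sumFin-remove n f i ⟩
    f i + sumFin R n (removeAt f i)        ≈⟨ +-cong fi≈ (sumFin-cong n off′) ⟩
    (c + g i) + sumFin R n (removeAt g i)  ≈⟨ +-assoc c (g i) _ ⟩
    c + (g i + sumFin R n (removeAt g i))  ≈⟨ +-congˡ (sumFin-remove n g i) ⟨
    c + sumFin R (suc n) g                 ∎
    where
    off′ : ∀ j → removeAt f i j ≈ removeAt g i j
    off′ j = off _ (punchInᵢ≢i i j)

module RingLemmas {r ℓ : Level} (R : CommutativeRing r ℓ) where
  open CommutativeRing R
  open import Algebra.Properties.Ring ring
    using (-‿distribˡ-*; -‿distribʳ-*; -‿involutive; x∙y⁻¹≈ε⇒x≈y)
  open import Relation.Binary.Reasoning.Setoid setoid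

  signum : Bool → Carrier
  signum true  = 1#
  signum false = - 1#

  -x*-y≈x*y : ∀ x y → - x * - y ≈ x * y
  -x*-y≈x*y x y = begin
    - x * - y    ≈⟨ -‿distribˡ-* x (- y) ⟨
    - (x * - y)  ≈⟨ -‿cong (-‿distribʳ-* x y) ⟨
    - - (x * y)  ≈⟨ -‿involutive (x * y) ⟩
    x * y        ∎

  -x*y≈-y*x : ∀ x y → - x * y ≈ - y * x
  -x*y≈-y*x x y =
    trans (sym (-‿distribˡ-* x y)) (trans (-‿cong (*-comm x y)) (-‿distribˡ-* y x))

  x*y+-y*x≈0 : ∀ x y → x * y + - y * x ≈ 0#
  x*y+-y*x≈0 x y =
    trans (+-congˡ (trans (sym (-‿distribˡ-* y x)) (-‿cong (*-comm y x)))) (-‿inverseʳ (x * y))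

  x+-y*z≈0⇒x≈y*z : ∀ {x} y z → x + - y * z ≈ 0# → x ≈ y * z
  x+-y*z≈0⇒x≈y*z {x} y z eq = x∙y⁻¹≈ε⇒x≈y x (y * z) (trans (+-congˡ (-‿distribˡ-* y z)) eq)

  *≈0+*≈0 : ∀ {s t u v} → u ≈ 0# → v ≈ 0# → s * u + t * v ≈ 0#
  *≈0+*≈0 {s} {t} u≈0 v≈0 =
    trans (+-cong (trans (*-congˡ u≈0) (zeroʳ s)) (trans (*-congˡ v≈0) (zeroʳ t))) (+-identityʳ 0#)

module OrderedField {c ℓ₁ ℓ₂ : Level} (𝕂 : RealField c ℓ₁ ℓ₂) where
  open RealField 𝕂 using (commRing; _<_; _≤_; <-isStrictTotalOrder; +-monoˡ-<; *-pos; inverse)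
  open CommutativeRing commRing hiding (zero)
  open IsStrictTotalOrder <-isStrictTotalOrder
    using (compare; irrefl; <-respʳ-≈; <-respˡ-≈; _≟_) renaming (trans to <-trans)
  open import Algebra.Properties.Ring ring using (-‿distribʳ-*; -‿involutive; -1*x≈-x)
  open import Algebra.Solver.Ring.NaturalCoefficients.Default commutativeSemiring
  open import Relation.Binary.Reasoning.Setoid setoid
  open SumFin commRing
  open RingLemmas commRing

  Side : Bool → Carrier → Set ℓ₂
  Side true  a = 0# < a
  Side false a = a < 0#

  Side-resp-≈ : ∀ b {a a′} → a ≈ a′ → Side b a → Side b a′
  Side-resp-≈ true  a≈a′ = <-respʳ-≈ a≈a′
  Side-resp-≈ false a≈a′ = <-respˡ-≈ a≈a′

  Side⇒≉0 : ∀ b {a} → Side b a → ¬ a ≈ 0#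
  Side⇒≉0 true  0<a a≈0 = irrefl (sym a≈0) 0<a
  Side⇒≉0 false a<0 a≈0 = irrefl a≈0 a<0

  ≉0⇒Side : ∀ {a} → ¬ a ≈ 0# → Σ Bool (λ b → Side b a)
  ≉0⇒Side {a} a≉0 with compare 0# a
  ... | tri< 0<a _ _ = true , 0<a
  ... | tri≈ _ 0≈a _ = contradiction (sym 0≈a) a≉0
  ... | tri> _ _ a<0 = false , a<0

  0<*⇒≉0ʳ : ∀ {a b} → 0# < a * b → ¬ b ≈ 0#
  0<*⇒≉0ʳ {a} 0<ab b≈0 = Side⇒≉0 true 0<ab (trans (*-congˡ b≈0) (zeroʳ a))

  0<⇒-<0 : ∀ {a} → 0# < a → - a < 0#
  0<⇒-<0 {a} 0<a =
    <-respˡ-≈ (+-identityˡ (- a)) (<-respʳ-≈ (-‿inverseʳ a) (+-monoˡ-< (- a) 0<a))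

  <0⇒0<- : ∀ {a} → a < 0# → 0# < - a
  <0⇒0<- {a} a<0 =
    <-respˡ-≈ (-‿inverseʳ a) (<-respʳ-≈ (+-identityˡ (- a)) (+-monoˡ-< (- a) a<0))

  Side⇒0<signum* : ∀ b {a} → Side b a → 0# < signum b * a
  Side⇒0<signum* true  {a} 0<a = <-respʳ-≈ (sym (*-identityˡ a)) 0<a
  Side⇒0<signum* false {a} a<0 = <-respʳ-≈ (sym (-1*x≈-x a)) (<0⇒0<- a<0)

  0<⇒Side-signum* : ∀ b {a} → 0# < a → Side b (signum b * a)
  0<⇒Side-signum* true  {a} 0<a = <-respʳ-≈ (sym (*-identityˡ a)) 0<a
  0<⇒Side-signum* false {a} 0<a = <-respˡ-≈ (sym (-1*x≈-x a)) (0<⇒-<0 0<a)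

  0<-cancelˡ : ∀ {a b} → 0# < a → 0# < a * b → 0# < b
  0<-cancelˡ {a} {b} 0<a 0<ab with compare 0# b
  ... | tri< 0<b _ _ = 0<b
  ... | tri≈ _ 0≈b _ = contradiction (sym 0≈b) (0<*⇒≉0ʳ 0<ab)
  ... | tri> _ _ b<0 = contradiction (<-trans 0<ab ab<0) (irrefl refl)
    where
    ab<0 : a * b < 0#
    ab<0 = <-respˡ-≈ (trans (-‿cong (sym (-‿distribʳ-* a b))) (-‿involutive (a * b)))
                     (0<⇒-<0 (*-pos 0<a (<0⇒0<- b<0)))

  Side-cancelˡ : ∀ s {a b} → Side s a → 0# < a * b → Side s b
  Side-cancelˡ true  0<a 0<ab = 0<-cancelˡ 0<a 0<ab
  Side-cancelˡ false {a} {b} a<0 0<ab = <-respˡ-≈ (-‿involutive b)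
    (0<⇒-<0 (0<-cancelˡ (<0⇒0<- a<0) (<-respʳ-≈ (sym (-x*-y≈x*y a b)) 0<ab)))

  0≈⇒0≤ : ∀ {a} → 0# ≈ a → 0# ≤ a
  0≈⇒0≤ 0≈a a<0 = irrefl (sym 0≈a) a<0

  0<⇒0≤ : ∀ {a} → 0# < a → 0# ≤ a
  0<⇒0≤ 0<a a<0 = irrefl refl (<-trans a<0 0<a)

  0≤⇒0<⊎0≈ : ∀ {a} → 0# ≤ a → 0# < a ⊎ 0# ≈ a
  0≤⇒0<⊎0≈ {a} 0≤a with compare 0# a
  ... | tri< 0<a _ _ = inj₁ 0<a
  ... | tri≈ _ 0≈a _ = inj₂ 0≈a
  ... | tri> _ _ a<0 = contradiction a<0 0≤a

  0≤-resp-≈ : ∀ {a b} → a ≈ b → 0# ≤ a → 0# ≤ b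
  0≤-resp-≈ a≈b 0≤a b<0 = 0≤a (<-respˡ-≈ (sym a≈b) b<0)

  x*x-pos : ∀ {x} → ¬ x ≈ 0# → 0# < x * x
  x*x-pos {x} x≉0 with ≉0⇒Side x≉0
  ... | true  , 0<x = *-pos 0<x 0<x
  ... | false , x<0 = <-respʳ-≈ (-x*-y≈x*y x x) (*-pos (<0⇒0<- x<0) (<0⇒0<- x<0))

  x*x-nonneg : ∀ x → 0# ≤ x * x
  x*x-nonneg x with x ≟ 0#
  ... | yes x≈0 = 0≈⇒0≤ (sym (trans (*-congˡ x≈0) (zeroʳ x)))
  ... | no x≉0  = 0<⇒0≤ (x*x-pos x≉0)

  +-pos-nonneg : ∀ {a b} → 0# < a → 0# ≤ b → 0# < a + b
  +-pos-nonneg {a} {b} 0<a 0≤b with 0≤⇒0<⊎0≈ 0≤b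
  ... | inj₁ 0<b = <-trans (<-respʳ-≈ (sym (+-identityˡ b)) 0<b) (+-monoˡ-< b 0<a)
  ... | inj₂ 0≈b = <-respʳ-≈ (trans (sym (+-identityʳ a)) (+-congˡ 0≈b)) 0<a

  +-nonneg : ∀ {a b} → 0# ≤ a → 0# ≤ b → 0# ≤ a + b
  +-nonneg {a} {b} 0≤a 0≤b with 0≤⇒0<⊎0≈ 0≤a
  ... | inj₁ 0<a = 0<⇒0≤ (+-pos-nonneg 0<a 0≤b)
  ... | inj₂ 0≈a = 0≤-resp-≈ (trans (sym (+-identityˡ b)) (+-congʳ 0≈a)) 0≤b

  *-nonneg : ∀ {a b} → 0# ≤ a → 0# ≤ b → 0# ≤ a * b
  *-nonneg {a} {b} 0≤a 0≤b with 0≤⇒0<⊎0≈ 0≤a | 0≤⇒0<⊎0≈ 0≤b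
  ... | inj₁ 0<a | inj₁ 0<b = 0<⇒0≤ (*-pos 0<a 0<b)
  ... | inj₂ 0≈a | _        = 0≈⇒0≤ (sym (trans (*-congʳ (sym 0≈a)) (zeroˡ b)))
  ... | _        | inj₂ 0≈b = 0≈⇒0≤ (sym (trans (*-congˡ (sym 0≈b)) (zeroʳ a)))

  sumFin-nonneg : ∀ n {w : Fin n → Carrier} → (∀ l → 0# ≤ w l) → 0# ≤ sumFin commRing n w
  sumFin-nonneg zero    _   = 0≈⇒0≤ refl
  sumFin-nonneg (suc n) 0≤w = +-nonneg (0≤w zero) (sumFin-nonneg n (0≤w ∘ suc))

  sumFin-nonneg-split : ∀ n {w : Fin n → Carrier} → (∀ l → 0# ≤ w l) → ∀ k →
                        Σ Carrier (λ r → 0# ≤ r × sumFin commRing n w ≈ w k + r)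
  sumFin-nonneg-split (suc n) {w} 0≤w k =
    sumFin commRing n (removeAt w k) , sumFin-nonneg n (0≤w ∘ punchIn k) , sumFin-remove n w k

  a*a+a*b+b*b-pos : ∀ {a} b → ¬ a ≈ 0# → 0# < a * a + a * b + b * b
  a*a+a*b+b*b-pos {a} b a≉0 with compare 0# (a * b)
  ... | tri< _ _ 0≤ab = +-pos-nonneg (+-pos-nonneg (x*x-pos a≉0) 0≤ab) (x*x-nonneg b)
  ... | tri≈ _ _ 0≤ab = +-pos-nonneg (+-pos-nonneg (x*x-pos a≉0) 0≤ab) (x*x-nonneg b)
  ... | tri> _ _ ab<0 = <-respʳ-≈ completed-square
    (<-respʳ-≈ (+-comm _ _) (+-pos-nonneg (<0⇒0<- ab<0) (x*x-nonneg (a + b))))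
    where
    completed-square : (a + b) * (a + b) + - (a * b) ≈ a * a + a * b + b * b
    completed-square = begin
      (a + b) * (a + b) + - (a * b)                  ≈⟨ +-congʳ square-expansion ⟩
      (a * a + a * b + b * b) + a * b + - (a * b)    ≈⟨ +-assoc _ _ _ ⟩
      (a * a + a * b + b * b) + (a * b + - (a * b))  ≈⟨ +-congˡ (-‿inverseʳ (a * b)) ⟩
      (a * a + a * b + b * b) + 0#                   ≈⟨ +-identityʳ _ ⟩
      a * a + a * b + b * b                          ∎
      where
      square-expansion : (a + b) * (a + b) ≈ (a * a + a * b + b * b) + a * b
      square-expansion =
        solve 2 (λ a b → (a :+ b) :* (a :+ b) := (a :* a :+ a :* b :+ b :* b) :+ a :* b) refl a b

  -- A total inverse: 0 ⁻¹ = 0 is a junk value.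
  infix 8 _⁻¹
  _⁻¹ : Carrier → Carrier
  a ⁻¹ with a ≟ 0#
  ... | yes _  = 0#
  ... | no a≉0 = proj₁ (inverse a a≉0)

  *-inverseʳ : ∀ {a} → ¬ a ≈ 0# → a * a ⁻¹ ≈ 1#
  *-inverseʳ {a} a≉0 with a ≟ 0#
  ... | yes a≈0  = contradiction a≈0 a≉0
  ... | no a≉0′ = proj₂ (inverse a a≉0′)

  *-cancelˡ-≈0 : ∀ {a b} → ¬ a ≈ 0# → a * b ≈ 0# → b ≈ 0#
  *-cancelˡ-≈0 {a} {b} a≉0 ab≈0 = begin
    b                ≈⟨ *-identityˡ b ⟨
    1# * b           ≈⟨ *-congʳ (*-inverseʳ a≉0) ⟨
    a * a ⁻¹ * b     ≈⟨ solve 3 (λ a a′ b → a :* a′ :* b := a′ :* (a :* b)) refl a (a ⁻¹) b ⟩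
    a ⁻¹ * (a * b)   ≈⟨ *-congˡ ab≈0 ⟩
    a ⁻¹ * 0#        ≈⟨ zeroʳ (a ⁻¹) ⟩
    0#               ∎

  sideOr : Bool → Carrier → Bool
  sideOr b a with compare 0# a
  ... | tri< _ _ _ = true
  ... | tri≈ _ _ _ = b
  ... | tri> _ _ _ = false

  sideOr-≈0 : ∀ b {a} → a ≈ 0# → sideOr b a ≡ b
  sideOr-≈0 b {a} a≈0 with compare 0# a
  ... | tri< 0<a _ _ = contradiction a≈0 (Side⇒≉0 true 0<a)
  ... | tri≈ _ _ _   = ≡.refl
  ... | tri> _ _ a<0 = contradiction a≈0 (Side⇒≉0 false a<0)

  sideOr-≉0 : ∀ b b′ {a} → ¬ a ≈ 0# → sideOr b a ≡ sideOr b′ a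
  sideOr-≉0 b b′ {a} a≉0 with compare 0# a
  ... | tri< _ _ _   = ≡.refl
  ... | tri≈ _ 0≈a _ = contradiction (sym 0≈a) a≉0
  ... | tri> _ _ _   = ≡.refl

  Side-sideOr : ∀ b {a x} → (¬ a ≈ 0# → 0# < a * x) → (a ≈ 0# → Side b x) → Side (sideOr b a) x
  Side-sideOr b {a} same-side on-zero with compare 0# a
  ... | tri< 0<a _ _ = Side-cancelˡ true 0<a (same-side (Side⇒≉0 true 0<a))
  ... | tri≈ _ 0≈a _ = on-zero (sym 0≈a)
  ... | tri> _ _ a<0 = Side-cancelˡ false a<0 (same-side (Side⇒≉0 false a<0))

module Geometry {c ℓ₁ ℓ₂ : Level} (𝕂 : RealField c ℓ₁ ℓ₂) (A : Arrangement 𝕂) where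
  open RealField 𝕂 using (commRing; _<_; <-isStrictTotalOrder)
  open CommutativeRing commRing hiding (zero)
  open IsStrictTotalOrder <-isStrictTotalOrder using (<-respʳ-≈; _≟_)
  open import Algebra.Solver.Ring.NaturalCoefficients.Default commutativeSemiring
  open import Relation.Binary.Reasoning.Setoid setoid
  open SumFin commRing
  open RingLemmas commRing
  open OrderedField 𝕂
  open Arrangement A

  Pt : Set c
  Pt = Point 𝕂 dim

  infix  8 _∙_
  infixl 6 _+ᵖ_
  infixr 7 _·ᵖ_

  _∙_ : Pt → Pt → Carrier
  _∙_ = eval 𝕂

  _+ᵖ_ : Pt → Pt → Pt
  (x +ᵖ y) m = x m + y m

  _·ᵖ_ : Carrier → Pt → Pt
  (t ·ᵖ x) m = t * x m

  0ᵖ : Pt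
  0ᵖ _ = 0#

  ∙-comm : ∀ a z → a ∙ z ≈ z ∙ a
  ∙-comm a z = sumFin-cong dim (λ m → *-comm (a m) (z m))

  ∙-+ʳ : ∀ a x y → a ∙ (x +ᵖ y) ≈ a ∙ x + a ∙ y
  ∙-+ʳ a x y = trans (sumFin-cong dim (λ m → distribˡ (a m) (x m) (y m))) (sumFin-+ dim _ _)

  ∙-·ʳ : ∀ a t x → a ∙ (t ·ᵖ x) ≈ t * a ∙ x
  ∙-·ʳ a t x = trans (sumFin-cong dim (λ m → swap-factors (a m) (x m))) (sumFin-*ˡ dim t _)
    where
    swap-factors : ∀ u v → u * (t * v) ≈ t * (u * v)
    swap-factors = solve 3 (λ t u v → u :* (t :* v) := t :* (u :* v)) refl t

  ∙-+ˡ : ∀ x y z → (x +ᵖ y) ∙ z ≈ x ∙ z + y ∙ z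
  ∙-+ˡ x y z = trans (∙-comm _ z) (trans (∙-+ʳ z x y) (+-cong (∙-comm z x) (∙-comm z y)))

  ∙-·ˡ : ∀ t x z → (t ·ᵖ x) ∙ z ≈ t * x ∙ z
  ∙-·ˡ t x z = trans (∙-comm _ z) (trans (∙-·ʳ z t x) (*-congˡ (∙-comm z x)))

  ∙-0ᵖ : ∀ a → a ∙ 0ᵖ ≈ 0#
  ∙-0ᵖ a = sumFin-zero dim (λ m → zeroʳ (a m))

  ∙-self-≉0 : ∀ γ m → ¬ γ m ≈ 0# → ¬ γ ∙ γ ≈ 0#
  ∙-self-≉0 γ m γm≉0 =
    let r , 0≤r , γ∙γ≈ = sumFin-nonneg-split dim (λ l → x*x-nonneg (γ l)) m
    in Side⇒≉0 true (<-respʳ-≈ (sym γ∙γ≈) (+-pos-nonneg (x*x-pos γm≉0) 0≤r))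

  form-dichotomy : ∀ γ → (∀ z → γ ∙ z ≈ 0#) ⊎ ¬ γ ∙ γ ≈ 0#
  form-dichotomy γ with all? (λ m → γ m ≟ 0#)
  ... | yes γ≈0 = inj₁ (λ z → sumFin-zero dim (λ m → trans (*-congʳ (γ≈0 m)) (zeroˡ (z m))))
  ... | no γ≉0  = let m , γm≉0 = ¬∀⟶∃¬ dim _ (λ m → γ m ≟ 0#) γ≉0 in inj₂ (∙-self-≉0 γ m γm≉0)

  -- projᵀ i a is the adjoint of proj i a: it turns the linear form z ↦ β ∙ proj i a z into a
  -- coefficient vector, to which form-dichotomy applies.
  proj : Fin n → Pt → Pt → Pt
  proj i a z = (α i ∙ a) ·ᵖ z +ᵖ (- (α i ∙ z)) ·ᵖ a

  projᵀ : Fin n → Pt → Pt → Pt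
  projᵀ i a β = (α i ∙ a) ·ᵖ β +ᵖ (- (β ∙ a)) ·ᵖ α i

  ∙-proj : ∀ β i a z → β ∙ proj i a z ≈ α i ∙ a * β ∙ z + - (α i ∙ z) * β ∙ a
  ∙-proj β i a z = trans (∙-+ʳ β _ _) (+-cong (∙-·ʳ β _ z) (∙-·ʳ β _ a))

  projᵀ-∙ : ∀ i a β z → projᵀ i a β ∙ z ≈ α i ∙ a * β ∙ z + - (β ∙ a) * α i ∙ z
  projᵀ-∙ i a β z = trans (∙-+ˡ _ _ z) (+-cong (∙-·ˡ _ β z) (∙-·ˡ _ (α i) z))

  projᵀ-adjoint : ∀ i a β z → projᵀ i a β ∙ z ≈ β ∙ proj i a z
  projᵀ-adjoint i a β z = begin
    projᵀ i a β ∙ z                        ≈⟨ projᵀ-∙ i a β z ⟩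
    α i ∙ a * β ∙ z + - (β ∙ a) * α i ∙ z  ≈⟨ +-congˡ (-x*y≈-y*x (β ∙ a) (α i ∙ z)) ⟩
    α i ∙ a * β ∙ z + - (α i ∙ z) * β ∙ a  ≈⟨ ∙-proj β i a z ⟨
    β ∙ proj i a z                         ∎

  proj-∈H : ∀ i a z → α i ∙ proj i a z ≈ 0#
  proj-∈H i a z = trans (∙-proj (α i) i a z) (x*y+-y*x≈0 (α i ∙ a) (α i ∙ z))

  proj-preserves-H : ∀ β i {a z} → β ∙ a ≈ 0# → β ∙ z ≈ 0# → β ∙ proj i a z ≈ 0#
  proj-preserves-H β i βa≈0 βz≈0 = trans (∙-proj β i _ _) (*≈0+*≈0 βz≈0 βa≈0)

  projᵀ-on-H : ∀ i a β {z} → α i ∙ z ≈ 0# → projᵀ i a β ∙ z ≈ α i ∙ a * β ∙ z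
  projᵀ-on-H i a β {z} iz≈0 =
    trans (projᵀ-∙ i a β z) (trans (+-congˡ (trans (*-congˡ iz≈0) (zeroʳ _))) (+-identityʳ _))

  H⊆H⇒H⊇H : ∀ i k → (∀ z → α i ∙ z ≈ 0# → α k ∙ z ≈ 0#) → ∀ z → α k ∙ z ≈ 0# → α i ∙ z ≈ 0#
  H⊆H⇒H⊇H i k Hi⊆Hk z kz≈0 = *-cancelˡ-≈0 ka≉0 (begin
    α k ∙ a * α i ∙ z  ≈⟨ *-comm _ _ ⟩
    α i ∙ z * α k ∙ a  ≈⟨ proportional z ⟨
    α i ∙ a * α k ∙ z  ≈⟨ *-congˡ kz≈0 ⟩
    α i ∙ a * 0#       ≈⟨ zeroʳ _ ⟩
    0#                 ∎)
    where
    a : Pt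
    a = proj₁ (nonzero i)
    ia≉0 : ¬ α i ∙ a ≈ 0#
    ia≉0 = proj₂ (nonzero i)
    proportional : ∀ y → α i ∙ a * α k ∙ y ≈ α i ∙ y * α k ∙ a
    proportional y =
      x+-y*z≈0⇒x≈y*z _ _ (trans (sym (∙-proj (α k) i a y)) (Hi⊆Hk _ (proj-∈H i a y)))
    ka≉0 : ¬ α k ∙ a ≈ 0#
    ka≉0 ka≈0 = proj₂ (nonzero k)
      (*-cancelˡ-≈0 ia≉0 (trans (proportional _) (trans (*-congˡ ka≈0) (zeroʳ _))))

  hyperplane-avoid : ∀ i k → i ≢ k → Σ Pt (λ w → α i ∙ w ≈ 0# × ¬ α k ∙ w ≈ 0#)
  hyperplane-avoid i k i≢k with nonzero i
  ... | a , ia≉0 with form-dichotomy (projᵀ i a (α k))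
  ...   | inj₂ γ∙γ≉0 = proj i a (projᵀ i a (α k)) , proj-∈H i a _ ,
                       λ kw≈0 → γ∙γ≉0 (trans (projᵀ-adjoint i a (α k) _) kw≈0)
  ...   | inj₁ γ≈0 = contradiction (λ z → Hi⊆Hk z , H⊆H⇒H⊇H i k Hi⊆Hk z) (distinct i k i≢k)
    where
    Hi⊆Hk : ∀ z → α i ∙ z ≈ 0# → α k ∙ z ≈ 0#
    Hi⊆Hk z iz≈0 = *-cancelˡ-≈0 ia≉0 (trans (sym (projᵀ-on-H i a (α k) iz≈0)) (γ≈0 z))

  codim2-avoid : GenericCodim2 𝕂 A → ∀ i j → i ≢ j → ∀ k → k ≢ i → k ≢ j →
                 Σ Pt (λ w → (α i ∙ w ≈ 0# × α j ∙ w ≈ 0#) × ¬ α k ∙ w ≈ 0#)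
  codim2-avoid gen i j i≢j k k≢i k≢j
    with hyperplane-avoid j i (i≢j ∘ ≡.sym) | hyperplane-avoid i j i≢j
  ... | a , ja≈0 , ia≉0 | b , ib≈0 , jb≉0 with form-dichotomy (projᵀ i a (projᵀ j b (α k)))
  ...   | inj₂ γ∙γ≉0 = w , (proj-preserves-H (α i) j ib≈0 (proj-∈H i a γ) , proj-∈H j b _) , kw≉0
    where
    γ w : Pt
    γ = projᵀ i a (projᵀ j b (α k))
    w = proj j b (proj i a γ)
    kw≉0 : ¬ α k ∙ w ≈ 0#
    kw≉0 kw≈0 = γ∙γ≉0 (begin
      γ ∙ γ                         ≈⟨ projᵀ-adjoint i a _ γ ⟩
      projᵀ j b (α k) ∙ proj i a γ  ≈⟨ projᵀ-adjoint j b (α k) _ ⟩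
      α k ∙ w                       ≈⟨ kw≈0 ⟩
      0#                            ∎)
  ...   | inj₁ γ≈0 = ⊥-elim ([ k≢i , k≢j ] (gen i j i≢j k Hij⊆Hk))
    where
    Hij⊆Hk : ∀ z → α i ∙ z ≈ 0# → α j ∙ z ≈ 0# → α k ∙ z ≈ 0#
    Hij⊆Hk z iz≈0 jz≈0 = *-cancelˡ-≈0 jb≉0 (*-cancelˡ-≈0 ia≉0 (begin
      α i ∙ a * (α j ∙ b * α k ∙ z)    ≈⟨ *-congˡ (projᵀ-on-H j b (α k) jz≈0) ⟨
      α i ∙ a * projᵀ j b (α k) ∙ z    ≈⟨ projᵀ-on-H i a _ iz≈0 ⟨
      projᵀ i a (projᵀ j b (α k)) ∙ z  ≈⟨ γ≈0 z ⟩
      0#                               ∎))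

  -- scale p d ≥ 1 + (α_k d / α_k p)² for every k with α_k p ≠ 0, which is what keeps
  -- push p d on the side of p of every hyperplane avoiding p (push-off).
  ratio : Pt → Pt → Fin n → Carrier
  ratio p d l = α l ∙ d * (α l ∙ p) ⁻¹

  scale : Pt → Pt → Carrier
  scale p d = 1# + sumFin commRing n (λ l → ratio p d l * ratio p d l)

  push : Pt → Pt → Pt
  push p d = scale p d ·ᵖ p +ᵖ d

  ∙-push : ∀ β p d → β ∙ push p d ≈ scale p d * β ∙ p + β ∙ d
  ∙-push β p d = trans (∙-+ʳ β _ d) (+-congʳ (∙-·ʳ β _ p))

  push-on : ∀ β {p} d → β ∙ p ≈ 0# → β ∙ push p d ≈ β ∙ d
  push-on β {p} d βp≈0 =
    trans (∙-push β p d) (trans (+-congʳ (trans (*-congˡ βp≈0) (zeroʳ _))) (+-identityˡ _))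

  push-off : ∀ k {p} d → ¬ α k ∙ p ≈ 0# → 0# < α k ∙ p * α k ∙ push p d
  push-off k {p} d kp≉0 =
    let r , 0≤r , scale≈ = sumFin-nonneg-split n (λ l → x*x-nonneg (ratio p d l)) k
    in <-respʳ-≈ (sym (expand r scale≈))
                 (+-pos-nonneg (a*a+a*b+b*b-pos b kp≉0) (*-nonneg 0≤r (x*x-nonneg a)))
    where
    a b w : Carrier
    a = α k ∙ p
    b = α k ∙ d
    w = ratio p d k * ratio p d k
    w*a*a≈b*b : w * (a * a) ≈ b * b
    w*a*a≈b*b = begin
      (b * a ⁻¹) * (b * a ⁻¹) * (a * a)  ≈⟨ regroup a (a ⁻¹) b ⟩
      b * b * ((a * a ⁻¹) * (a * a ⁻¹))  ≈⟨ *-congˡ (*-cong (*-inverseʳ kp≉0) (*-inverseʳ kp≉0)) ⟩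
      b * b * (1# * 1#)                  ≈⟨ trans (*-congˡ (*-identityˡ 1#)) (*-identityʳ _) ⟩
      b * b                              ∎
      where
      regroup : ∀ a a′ b → (b * a′) * (b * a′) * (a * a) ≈ b * b * ((a * a′) * (a * a′))
      regroup = solve 3 (λ a a′ b → (b :* a′) :* (b :* a′) :* (a :* a) :=
                                    b :* b :* ((a :* a′) :* (a :* a′))) refl
    expand : ∀ r → sumFin commRing n (λ l → ratio p d l * ratio p d l) ≈ w + r →
             a * α k ∙ push p d ≈ (a * a + a * b + b * b) + r * (a * a)
    expand r scale≈ = begin
      a * α k ∙ push p d
        ≈⟨ *-congˡ (trans (∙-push (α k) p d) (+-congʳ (*-congʳ (+-congˡ scale≈)))) ⟩
      a * ((1# + (w + r)) * a + b)
        ≈⟨ solve 4 (λ a b w r → a :* ((con 1 :+ (w :+ r)) :* a :+ b) :=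
                                (a :* a :+ a :* b :+ w :* (a :* a)) :+ r :* (a :* a)) refl a b w r ⟩
      (a * a + a * b + w * (a * a)) + r * (a * a)
        ≈⟨ +-congʳ (+-congˡ w*a*a≈b*b) ⟩
      (a * a + a * b + b * b) + r * (a * a)
        ∎

  Flat : (Fin n → Set) → Pt → Set ℓ₁
  Flat Z y = ∀ k → Z k → α k ∙ y ≈ 0#

  flat-generic-point : {Z : Fin n → Set} → Decidable Z →
                       (∀ k → ¬ Z k → Σ Pt (λ w → Flat Z w × ¬ α k ∙ w ≈ 0#)) →
                       Σ Pt (λ p → Flat Z p × (∀ k → α k ∙ p ≈ 0# → Z k))
  flat-generic-point {Z} Z? avoid = generic (build (allFin n))
    where
    Avoids : Pt → Fin n → Set ℓ₁
    Avoids y k = ¬ Z k → ¬ α k ∙ y ≈ 0#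

    build : (L : List (Fin n)) → Σ Pt (λ y → Flat Z y × All (Avoids y) L)
    build [] = 0ᵖ , (λ k _ → ∙-0ᵖ (α k)) , []
    build (k ∷ L) with build L
    ... | y , y∈Z , avoidsL with Z? k | α k ∙ y ≟ 0#
    ...   | yes zk | _        = y , y∈Z , (λ ¬zk → contradiction zk ¬zk) ∷ avoidsL
    ...   | no _   | no ky≉0 = y , y∈Z , (λ _ → ky≉0) ∷ avoidsL
    ...   | no ¬zk | yes ky≈0 with avoid k ¬zk
    ...     | w , w∈Z , kw≉0 =
              push y w ,
              (λ l zl → trans (push-on (α l) w (y∈Z l zl)) (w∈Z l zl)) ,
              (λ _ → kw≉0 ∘ trans (sym (push-on (α k) w ky≈0))) ∷
              All.map (λ ly≉0 ¬zl → 0<*⇒≉0ʳ (push-off _ w (ly≉0 ¬zl))) avoidsL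

    generic : Σ Pt (λ y → Flat Z y × All (Avoids y) (allFin n)) →
              Σ Pt (λ p → Flat Z p × (∀ k → α k ∙ p ≈ 0# → Z k))
    generic (p , p∈Z , avoids) = p , p∈Z , λ k kp≈0 →
      decidable-stable (Z? k) (λ ¬zk → All.lookup avoids (∈-allFin k) ¬zk kp≈0)

  Side⇒InHalf : ∀ b {i x} → Side b (α i ∙ x) → InHalf 𝕂 A b i x
  Side⇒InHalf true  side = side
  Side⇒InHalf false side = side

  -- The sign vector of the points near p: the side of p on each hyperplane avoiding p,
  -- and the prescribed side τ k on each hyperplane H_k through p.
  beside : Pt → SignVec 𝕂 A → SignVec 𝕂 A
  beside p τ k = sideOr (τ k) (α k ∙ p)

  beside-chamber : ∀ {p τ} d → (∀ k → α k ∙ p ≈ 0# → Side (τ k) (α k ∙ d)) →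
                   IsChamber 𝕂 A (beside p τ)
  beside-chamber {p} {τ} d d-side = push p d , λ k →
    Side⇒InHalf (beside p τ k) (Side-sideOr (τ k) (push-off k d)
      (λ kp≈0 → Side-resp-≈ (τ k) (sym (push-on (α k) d kp≈0)) (d-side k kp≈0)))

  record Adjacent (i : Fin n) (s s′ : SignVec 𝕂 A) : Set (c ⊔ ℓ₂) where
    field
      chamber  : IsChamber 𝕂 A s
      chamber′ : IsChamber 𝕂 A s′
      positive : s i ≡ true
      negative : s′ i ≡ false
      agree    : ∀ k → k ≢ i → s k ≡ s′ k

  beside-adjacent : ∀ {p τ τ′} i → α i ∙ p ≈ 0# → τ i ≡ true → τ′ i ≡ false →
                    (∀ k → k ≢ i → α k ∙ p ≈ 0# → τ k ≡ τ′ k) →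
                    IsChamber 𝕂 A (beside p τ) → IsChamber 𝕂 A (beside p τ′) →
                    Adjacent i (beside p τ) (beside p τ′)
  beside-adjacent {p} {τ} {τ′} i ip≈0 τi τ′i agree-at-zeros ch ch′ = record
    { chamber  = ch
    ; chamber′ = ch′
    ; positive = ≡.trans (sideOr-≈0 (τ i) ip≈0) τi
    ; negative = ≡.trans (sideOr-≈0 (τ′ i) ip≈0) τ′i
    ; agree    = agree
    }
    where
    agree : ∀ k → k ≢ i → beside p τ k ≡ beside p τ′ k
    agree k k≢i with α k ∙ p ≟ 0#
    ... | yes kp≈0 = ≡.trans (sideOr-≈0 (τ k) kp≈0)
                       (≡.trans (agree-at-zeros k k≢i kp≈0) (≡.sym (sideOr-≈0 (τ′ k) kp≈0)))
    ... | no kp≉0  = sideOr-≉0 (τ k) (τ′ k) kp≉0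

  toward : Bool → Pt → Pt
  toward b u = signum b ·ᵖ u

  Side-toward : ∀ b β {u} → 0# < β ∙ u → Side b (β ∙ toward b u)
  Side-toward b β {u} 0<βu = Side-resp-≈ b (sym (∙-·ʳ β (signum b) u)) (0<⇒Side-signum* b 0<βu)

  toward-∈H : ∀ b β {u} → β ∙ u ≈ 0# → β ∙ toward b u ≈ 0#
  toward-∈H b β βu≈0 = trans (∙-·ʳ β _ _) (trans (*-congˡ βu≈0) (zeroʳ _))

  positive-multiple : ∀ β {w} → ¬ β ∙ w ≈ 0# →
                      Σ Pt (λ u → 0# < β ∙ u × (∀ γ → γ ∙ w ≈ 0# → γ ∙ u ≈ 0#))
  positive-multiple β {w} βw≉0 =
    let b , side = ≉0⇒Side βw≉0
    in toward b w , <-respʳ-≈ (sym (∙-·ʳ β (signum b) w)) (Side⇒0<signum* b side) ,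
       λ γ γw≈0 → toward-∈H b γ γw≈0

  adjacent-beside : ∀ {i p u} → α i ∙ p ≈ 0# → (∀ k → α k ∙ p ≈ 0# → k ≡ i) → 0# < α i ∙ u →
                    Adjacent i (beside p (const true)) (beside p (const false))
  adjacent-beside {i} {p} {u} ip≈0 zeros≡i 0<iu =
    beside-adjacent i ip≈0 ≡.refl ≡.refl (λ k k≢i kp≈0 → contradiction (zeros≡i k kp≈0) k≢i)
      (chamber true) (chamber false)
    where
    chamber : ∀ σ → IsChamber 𝕂 A (beside p (const σ))
    chamber σ = beside-chamber (toward σ u) on-zero
      where
      on-zero : ∀ k → α k ∙ p ≈ 0# → Side σ (α k ∙ toward σ u)
      on-zero k kp≈0 with zeros≡i k kp≈0
      ... | ≡.refl = Side-toward σ (α i) 0<iu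

  adjacent-pair : ∀ i → Σ (SignVec 𝕂 A) λ s → Σ (SignVec 𝕂 A) λ s′ → Adjacent i s s′
  adjacent-pair i =
    let p , p∈Hi , zeros≡i = flat-generic-point (_≟F i) avoid
        u , 0<iu , _ = positive-multiple (α i) (proj₂ (nonzero i))
    in beside p (const true) , beside p (const false) , adjacent-beside (p∈Hi i ≡.refl) zeros≡i 0<iu
    where
    avoid : ∀ k → k ≢ i → Σ Pt (λ w → Flat (_≡ i) w × ¬ α k ∙ w ≈ 0#)
    avoid k k≢i =
      let w , iw≈0 , kw≉0 = hyperplane-avoid i k (k≢i ∘ ≡.sym)
      in w , (λ { _ ≡.refl → iw≈0 }) , kw≉0

  Adjacent-sides : ∀ {i s s′} → Adjacent i s s′ → ∀ b →
                   Σ (SignVec 𝕂 A) (λ t → IsChamber 𝕂 A t × t i ≡ b)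
  Adjacent-sides {s = s}   adj true  = s  , Adjacent.chamber adj  , Adjacent.positive adj
  Adjacent-sides {s′ = s′} adj false = s′ , Adjacent.chamber′ adj , Adjacent.negative adj

  chamber-on-side : ∀ i b → Σ (SignVec 𝕂 A) (λ s → IsChamber 𝕂 A s × s i ≡ b)
  chamber-on-side i = Adjacent-sides (proj₂ (proj₂ (adjacent-pair i)))

  some-chamber : Σ (SignVec 𝕂 A) (IsChamber 𝕂 A)
  some-chamber =
    let p , _ , no-zeros = flat-generic-point {Z = λ _ → ⊥} (λ _ → no id)
                             (λ k _ → proj₁ (nonzero k) , (λ _ ()) , proj₂ (nonzero k))
    in beside p (const true) , beside-chamber 0ᵖ (λ k kp≈0 → ⊥-elim (no-zeros k kp≈0))

  -- s_ab lies on side a of H_i and on side b of H_j.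
  record Square (i j : Fin n) : Set (c ⊔ ℓ₂) where
    field
      s₁₁ s₀₁ s₁₀ s₀₀ : SignVec 𝕂 A
      across-i₁ : Adjacent i s₁₁ s₀₁
      across-i₀ : Adjacent i s₁₀ s₀₀
      across-j  : Adjacent j s₁₁ s₁₀

  square-beside : ∀ {i j p u v} → i ≢ j → α i ∙ p ≈ 0# → α j ∙ p ≈ 0# →
                  (∀ k → α k ∙ p ≈ 0# → k ≡ i ⊎ k ≡ j) →
                  α j ∙ u ≈ 0# → 0# < α i ∙ u → α i ∙ v ≈ 0# → 0# < α j ∙ v → Square i j
  square-beside {i} {j} {p} {u} {v} i≢j ip≈0 jp≈0 zeros∈ij ju≈0 0<iu iv≈0 0<jv = record
    { s₁₁ = s true true ; s₀₁ = s false true ; s₁₀ = s true false ; s₀₀ = s false false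
    ; across-i₁ = across-i true
    ; across-i₀ = across-i false
    ; across-j  = across-j
    }
    where
    j≢i : j ≢ i
    j≢i = i≢j ∘ ≡.sym

    τ : Bool → Bool → SignVec 𝕂 A
    τ a b k = if does (k ≟F i) then a else b

    τ-i : ∀ a b → τ a b i ≡ a
    τ-i a b = ≡.cong (if_then a else b) (dec-true (i ≟F i) ≡.refl)

    τ-≢i : ∀ a b {k} → k ≢ i → τ a b k ≡ b
    τ-≢i a b {k} k≢i = ≡.cong (if_then a else b) (dec-false (k ≟F i) k≢i)

    s : Bool → Bool → SignVec 𝕂 A
    s a b = beside p (τ a b)

    d : Bool → Bool → Pt
    d a b = toward a u +ᵖ toward b v

    i∙d : ∀ a b → α i ∙ d a b ≈ α i ∙ toward a u
    i∙d a b = trans (∙-+ʳ (α i) _ _) (trans (+-congˡ (toward-∈H b (α i) iv≈0)) (+-identityʳ _))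

    j∙d : ∀ a b → α j ∙ d a b ≈ α j ∙ toward b v
    j∙d a b = trans (∙-+ʳ (α j) _ _) (trans (+-congʳ (toward-∈H a (α j) ju≈0)) (+-identityˡ _))

    chamber : ∀ a b → IsChamber 𝕂 A (s a b)
    chamber a b = beside-chamber (d a b) on-zero
      where
      on-zero : ∀ k → α k ∙ p ≈ 0# → Side (τ a b k) (α k ∙ d a b)
      on-zero k kp≈0 with zeros∈ij k kp≈0
      ... | inj₁ ≡.refl = ≡.subst (λ σ → Side σ (α i ∙ d a b)) (≡.sym (τ-i a b))
                            (Side-resp-≈ a (sym (i∙d a b)) (Side-toward a (α i) 0<iu))
      ... | inj₂ ≡.refl = ≡.subst (λ σ → Side σ (α j ∙ d a b)) (≡.sym (τ-≢i a b j≢i))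
                            (Side-resp-≈ b (sym (j∙d a b)) (Side-toward b (α j) 0<jv))

    across-i : ∀ b → Adjacent i (s true b) (s false b)
    across-i b = beside-adjacent i ip≈0 (τ-i true b) (τ-i false b)
                   (λ k k≢i _ → ≡.trans (τ-≢i true b k≢i) (≡.sym (τ-≢i false b k≢i)))
                   (chamber true b) (chamber false b)

    across-j : Adjacent j (s true true) (s true false)
    across-j = beside-adjacent j jp≈0 (τ-≢i true true j≢i) (τ-≢i true false j≢i) agree
                 (chamber true true) (chamber true false)
      where
      agree : ∀ k → k ≢ j → α k ∙ p ≈ 0# → τ true true k ≡ τ true false k
      agree k k≢j kp≈0 with zeros∈ij k kp≈0
      ... | inj₁ ≡.refl = ≡.trans (τ-i true true) (≡.sym (τ-i true false))
      ... | inj₂ k≡j    = contradiction k≡j k≢j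

  positive-point-in-H : ∀ {i j} → i ≢ j → Σ Pt (λ u → α j ∙ u ≈ 0# × 0# < α i ∙ u)
  positive-point-in-H {i} {j} i≢j =
    let w , jw≈0 , iw≉0 = hyperplane-avoid j i (i≢j ∘ ≡.sym)
        u , 0<iu , u∈ = positive-multiple (α i) iw≉0
    in u , u∈ (α j) jw≈0 , 0<iu

  square : GenericCodim2 𝕂 A → ∀ i j → i ≢ j → Square i j
  square gen i j i≢j =
    let p , p∈Hij , zeros∈ij = flat-generic-point (λ k → k ≟F i ⊎-dec k ≟F j) avoid
        u , ju≈0 , 0<iu = positive-point-in-H i≢j
        v , iv≈0 , 0<jv = positive-point-in-H (i≢j ∘ ≡.sym)
    in square-beside i≢j (p∈Hij i (inj₁ ≡.refl)) (p∈Hij j (inj₂ ≡.refl)) zeros∈ij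
                     ju≈0 0<iu iv≈0 0<jv
    where
    avoid : ∀ k → ¬ (k ≡ i ⊎ k ≡ j) → Σ Pt (λ w → Flat (λ k → k ≡ i ⊎ k ≡ j) w × ¬ α k ∙ w ≈ 0#)
    avoid k k∉ij =
      let w , (iw≈0 , jw≈0) , kw≉0 = codim2-avoid gen i j i≢j k (k∉ij ∘ inj₁) (k∉ij ∘ inj₂)
      in w , (λ { _ (inj₁ ≡.refl) → iw≈0 ; _ (inj₂ ≡.refl) → jw≈0 }) , kw≉0

module BoolValues {r ℓ : Level} (R : CommutativeRing r ℓ) where
  open CommutativeRing R hiding (zero)
  open import Algebra.Properties.Ring ring using (x∙y⁻¹≈ε⇒x≈y; -‿distribʳ-*; +-cancelˡ)
  open import Relation.Binary.Reasoning.Setoid setoid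
  open RingLemmas R using (signum)

  ⟦_⟧ : Bool → Carrier
  ⟦ b ⟧ = if b then 1# else 0#

  ⟦⟧-signum : ∀ σ → ⟦ σ ⟧ ≈ signum σ + ⟦ not σ ⟧
  ⟦⟧-signum true  = sym (+-identityʳ 1#)
  ⟦⟧-signum false = sym (-‿inverseˡ 1#)

  idempotent⇒⟦⟧ : IsIntegralDomain R → ∀ {a} → a * a ≈ a → Σ Bool (λ b → a ≈ ⟦ b ⟧)
  idempotent⇒⟦⟧ (_ , no-zero-divisors) {a} a*a≈a = from (no-zero-divisors a (a - 1#) a[a-1]≈0)
    where
    a[a-1]≈0 : a * (a - 1#) ≈ 0#
    a[a-1]≈0 = begin
      a * (a - 1#)      ≈⟨ distribˡ a a (- 1#) ⟩
      a * a + a * - 1#  ≈⟨ +-cong a*a≈a (trans (sym (-‿distribʳ-* a 1#)) (-‿cong (*-identityʳ a))) ⟩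
      a - a             ≈⟨ -‿inverseʳ a ⟩
      0#                ∎
    from : a ≈ 0# ⊎ a - 1# ≈ 0# → Σ Bool (λ b → a ≈ ⟦ b ⟧)
    from (inj₁ a≈0)   = false , a≈0
    from (inj₂ a-1≈0) = true , x∙y⁻¹≈ε⇒x≈y a 1# a-1≈0

  -- Both sides of ⟦ a ⟧ + ⟦ b′ ⟧ ≈ ⟦ a′ ⟧ + ⟦ b ⟧ lie in {0, 1, 2}, which are distinct in R.
  ⟦⟧-jump-injective : ¬ 1# ≈ 0# → CharNot2 R → ∀ {a b a′ b′ t} → a ≢ b →
                      ⟦ a ⟧ ≈ t + ⟦ b ⟧ → ⟦ a′ ⟧ ≈ t + ⟦ b′ ⟧ → a′ ≡ a × b′ ≡ b
  ⟦⟧-jump-injective 1≉0 2≉0 {a} {b} {a′} {b′} {t} a≢b a-jump a′-jump = cross a≢b (begin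
    ⟦ a ⟧ + ⟦ b′ ⟧      ≈⟨ +-congʳ a-jump ⟩
    t + ⟦ b ⟧ + ⟦ b′ ⟧  ≈⟨ swap-last t ⟦ b ⟧ ⟦ b′ ⟧ ⟩
    t + ⟦ b′ ⟧ + ⟦ b ⟧  ≈⟨ +-congʳ a′-jump ⟨
    ⟦ a′ ⟧ + ⟦ b ⟧      ∎)
    where
    swap-last : ∀ u v w → u + v + w ≈ u + w + v
    swap-last u v w = trans (+-assoc u v w) (trans (+-congˡ (+-comm v w)) (sym (+-assoc u w v)))

    from-true : ∀ {a′ b′} → 1# + ⟦ b′ ⟧ ≈ ⟦ a′ ⟧ + 0# → a′ ≡ true × b′ ≡ false
    from-true {true}  {false} _  = ≡.refl , ≡.refl
    from-true {false} {false} eq =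
      contradiction (trans (sym (+-identityʳ 1#)) (trans eq (+-identityʳ 0#))) 1≉0
    from-true {true}  {true}  eq = contradiction (+-cancelˡ 1# 1# 0# eq) 1≉0
    from-true {false} {true}  eq = contradiction (trans eq (+-identityʳ 0#)) 2≉0

    cross : ∀ {a b a′ b′} → a ≢ b → ⟦ a ⟧ + ⟦ b′ ⟧ ≈ ⟦ a′ ⟧ + ⟦ b ⟧ → a′ ≡ a × b′ ≡ b
    cross {true}  {true}  a≢b _  = contradiction ≡.refl a≢b
    cross {false} {false} a≢b _  = contradiction ≡.refl a≢b
    cross {true}  {false} _   eq = from-true eq
    cross {false} {true}  _   eq =
      swap (from-true (trans (+-comm _ _) (trans (sym eq) (+-comm _ _))))

module Heaviside {c ℓ₁ ℓ₂ r ℓr : Level} (𝕂 : RealField c ℓ₁ ℓ₂) (A : Arrangement 𝕂)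
                 (R : CommutativeRing r ℓr) where
  open CommutativeRing R hiding (zero)
  open import Algebra.Properties.Ring ring using (+-cancelʳ)
  open import Relation.Binary.Reasoning.Setoid setoid
  open Arrangement A using (n)
  open Geometry 𝕂 A
    using (Adjacent; module Adjacent; Square; module Square; adjacent-pair; square;
           chamber-on-side; some-chamber)
  open SumFin R
  open RingLemmas R using (signum)
  open BoolValues R

  affine : Carrier → (Fin n → Carrier) → SignVec 𝕂 A → Carrier
  affine c₀ cs s = c₀ + sumFin R n (λ j → cs j * ⟦ s j ⟧)

  affine-jump : ∀ c₀ cs {i s s′} → Adjacent i s s′ → affine c₀ cs s ≈ cs i + affine c₀ cs s′
  affine-jump c₀ cs {i} {s} {s′} adj = begin
    c₀ + sumFin R n (λ j → cs j * ⟦ s j ⟧)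
      ≈⟨ +-congˡ (sumFin-jump n i (cs i) agree′ jump-at-i) ⟩
    c₀ + (cs i + sumFin R n (λ j → cs j * ⟦ s′ j ⟧))
      ≈⟨ trans (sym (+-assoc _ _ _)) (trans (+-congʳ (+-comm _ _)) (+-assoc _ _ _)) ⟩
    cs i + affine c₀ cs s′
      ∎
    where
    open Adjacent adj
    agree′ : ∀ j → j ≢ i → cs j * ⟦ s j ⟧ ≈ cs j * ⟦ s′ j ⟧
    agree′ j j≢i = *-congˡ (reflexive (≡.cong ⟦_⟧ (agree j j≢i)))
    jump-at-i : cs i * ⟦ s i ⟧ ≈ cs i + cs i * ⟦ s′ i ⟧
    jump-at-i rewrite positive | negative =
      trans (*-identityʳ (cs i)) (sym (trans (+-congˡ (zeroʳ (cs i))) (+-identityʳ (cs i))))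

  affine-single : ∀ c₀ cs i → (∀ j → j ≢ i → cs j ≈ 0#) → ∀ s →
                  affine c₀ cs s ≈ c₀ + cs i * ⟦ s i ⟧
  affine-single c₀ cs i off s =
    +-congˡ (sumFin-single n i (λ j j≢i → trans (*-congʳ (off j j≢i)) (zeroˡ _)))

  heaviside-affine : ∀ σ i s → x 𝕂 A R σ i s ≈ ⟦ not σ ⟧ + signum σ * ⟦ s i ⟧
  heaviside-affine true  i s = sym (trans (+-identityˡ _) (*-identityˡ _))
  heaviside-affine false i s with s i
  ... | true  = sym (trans (+-congˡ (*-identityʳ (- 1#))) (-‿inverseʳ 1#))
  ... | false = sym (trans (+-congˡ (zeroʳ (- 1#))) (+-identityʳ 1#))

  heaviside-∈Fil1 : ∀ σ i → InFil1 𝕂 A R (x 𝕂 A R σ i)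
  heaviside-∈Fil1 σ i = ⟦ not σ ⟧ , cs , λ s _ → begin
    x 𝕂 A R σ i s                   ≈⟨ heaviside-affine σ i s ⟩
    ⟦ not σ ⟧ + signum σ * ⟦ s i ⟧  ≈⟨ +-congˡ (*-congʳ (reflexive cs-on)) ⟨
    ⟦ not σ ⟧ + cs i * ⟦ s i ⟧      ≈⟨ affine-single _ cs i cs-off s ⟨
    affine ⟦ not σ ⟧ cs s           ∎
    where
    cs : Fin n → Carrier
    cs j = if does (j ≟F i) then signum σ else 0#
    cs-on : cs i ≡ signum σ
    cs-on = ≡.cong (if_then signum σ else 0#) (dec-true (i ≟F i) ≡.refl)
    cs-off : ∀ j → j ≢ i → cs j ≈ 0#
    cs-off j j≢i = reflexive (≡.cong (if_then signum σ else 0#) (dec-false (j ≟F i) j≢i))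

  heaviside-idempotent : ∀ σ i s → x 𝕂 A R σ i s * x 𝕂 A R σ i s ≈ x 𝕂 A R σ i s
  heaviside-idempotent true  i s with s i
  ... | true  = *-identityˡ 1#
  ... | false = zeroˡ 0#
  heaviside-idempotent false i s with s i
  ... | true  = zeroˡ 0#
  ... | false = *-identityˡ 1#

  heaviside-on : ∀ σ i {s} → s i ≡ σ → x 𝕂 A R σ i s ≈ 1#
  heaviside-on true  i si≡σ rewrite si≡σ = refl
  heaviside-on false i si≡σ rewrite si≡σ = refl

  heaviside-off : ∀ σ i {s} → s i ≡ not σ → x 𝕂 A R σ i s ≈ 0#
  heaviside-off true  i si≡¬σ rewrite si≡¬σ = refl
  heaviside-off false i si≡¬σ rewrite si≡¬σ = refl

  heaviside⇒ : ¬ 1# ≈ 0# → ∀ {f} → InHeav 𝕂 A R f →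
               InFil1 𝕂 A R f × IsIdem 𝕂 A R f ×
               ¬ (_≈V_ 𝕂 A R f (0V 𝕂 A R)) × ¬ (_≈V_ 𝕂 A R f (1V 𝕂 A R))
  heaviside⇒ 1≉0 {f} (σ , i , f≈x) = ∈Fil1 , idempotent , ≉0 , ≉1
    where
    ∈Fil1 : InFil1 𝕂 A R f
    ∈Fil1 = let c₀ , cs , x≈ = heaviside-∈Fil1 σ i in c₀ , cs , λ s ch → trans (f≈x s ch) (x≈ s ch)
    idempotent : IsIdem 𝕂 A R f
    idempotent s ch =
      trans (*-cong (f≈x s ch) (f≈x s ch)) (trans (heaviside-idempotent σ i s) (sym (f≈x s ch)))
    ≉0 : ¬ (_≈V_ 𝕂 A R f (0V 𝕂 A R))
    ≉0 f≈0 = let s , ch , si≡σ = chamber-on-side i σ in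
      1≉0 (trans (sym (heaviside-on σ i si≡σ)) (trans (sym (f≈x s ch)) (f≈0 s ch)))
    ≉1 : ¬ (_≈V_ 𝕂 A R f (1V 𝕂 A R))
    ≉1 f≈1 = let s , ch , si≡¬σ = chamber-on-side i (not σ) in
      1≉0 (trans (sym (f≈1 s ch)) (trans (f≈x s ch) (heaviside-off σ i si≡¬σ)))

  module Recognise (domain : IsIntegralDomain R) (2≉0 : CharNot2 R) (gen : GenericCodim2 𝕂 A)
                   {f : VG 𝕂 A R} {c₀ : Carrier} {cs : Fin n → Carrier}
                   (f≈affine : ∀ s → IsChamber 𝕂 A s → f s ≈ affine c₀ cs s)
                   (idempotent : IsIdem 𝕂 A R f) where

    valued : ∀ {s} → IsChamber 𝕂 A s → Σ Bool (λ b → f s ≈ ⟦ b ⟧)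
    valued {s} ch = idempotent⇒⟦⟧ domain (idempotent s ch)

    jump : ∀ {i s s′ b b′} → Adjacent i s s′ → f s ≈ ⟦ b ⟧ → f s′ ≈ ⟦ b′ ⟧ → ⟦ b ⟧ ≈ cs i + ⟦ b′ ⟧
    jump {i} {s} {s′} {b} {b′} adj fs≈ fs′≈ = begin
      ⟦ b ⟧                   ≈⟨ fs≈ ⟨
      f s                     ≈⟨ f≈affine s (Adjacent.chamber adj) ⟩
      affine c₀ cs s          ≈⟨ affine-jump c₀ cs adj ⟩
      cs i + affine c₀ cs s′  ≈⟨ +-congˡ (f≈affine s′ (Adjacent.chamber′ adj)) ⟨
      cs i + f s′             ≈⟨ +-congˡ fs′≈ ⟩
      cs i + ⟦ b′ ⟧           ∎

    -- f steps across H_i when b⁺ i ≢ b⁻ i, that is, when cs i ≉ 0.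
    s⁺ s⁻ : Fin n → SignVec 𝕂 A
    s⁺ i = proj₁ (adjacent-pair i)
    s⁻ i = proj₁ (proj₂ (adjacent-pair i))

    pair : ∀ i → Adjacent i (s⁺ i) (s⁻ i)
    pair i = proj₂ (proj₂ (adjacent-pair i))

    value⁺ : ∀ i → Σ Bool (λ b → f (s⁺ i) ≈ ⟦ b ⟧)
    value⁺ i = valued (Adjacent.chamber (pair i))

    value⁻ : ∀ i → Σ Bool (λ b → f (s⁻ i) ≈ ⟦ b ⟧)
    value⁻ i = valued (Adjacent.chamber′ (pair i))

    b⁺ b⁻ : Fin n → Bool
    b⁺ i = proj₁ (value⁺ i)
    b⁻ i = proj₁ (value⁻ i)

    crossing : ∀ i → ⟦ b⁺ i ⟧ ≈ cs i + ⟦ b⁻ i ⟧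
    crossing i = jump (pair i) (proj₂ (value⁺ i)) (proj₂ (value⁻ i))

    level⇒cs≈0 : ∀ i → b⁺ i ≡ b⁻ i → cs i ≈ 0#
    level⇒cs≈0 i b⁺≡b⁻ = +-cancelʳ ⟦ b⁻ i ⟧ (cs i) 0#
      (trans (sym (crossing i)) (trans (reflexive (≡.cong ⟦_⟧ b⁺≡b⁻)) (sym (+-identityˡ _))))

    step-values : ∀ {i s s′ b b′} → b⁺ i ≢ b⁻ i → Adjacent i s s′ → f s ≈ ⟦ b ⟧ → f s′ ≈ ⟦ b′ ⟧ →
                  b ≡ b⁺ i × b′ ≡ b⁻ i
    step-values {i} step adj fs≈ fs′≈ =
      ⟦⟧-jump-injective (proj₁ domain) 2≉0 step (crossing i) (jump adj fs≈ fs′≈)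

    no-two-steps : ∀ {i j} → Square i j → b⁺ i ≢ b⁻ i → b⁺ j ≢ b⁻ j → ⊥
    no-two-steps {i} {j} sq step-i step-j =
      step-j (≡.trans (≡.sym b₁₁≡b⁺j) (≡.trans b₁₁≡b⁺i (≡.trans (≡.sym b₁₀≡b⁺i) b₁₀≡b⁻j)))
      where
      open Square sq
      v₁₁ : Σ Bool (λ b → f s₁₁ ≈ ⟦ b ⟧)
      v₁₁ = valued (Adjacent.chamber across-i₁)
      v₀₁ : Σ Bool (λ b → f s₀₁ ≈ ⟦ b ⟧)
      v₀₁ = valued (Adjacent.chamber′ across-i₁)
      v₁₀ : Σ Bool (λ b → f s₁₀ ≈ ⟦ b ⟧)
      v₁₀ = valued (Adjacent.chamber across-i₀)
      v₀₀ : Σ Bool (λ b → f s₀₀ ≈ ⟦ b ⟧)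
      v₀₀ = valued (Adjacent.chamber′ across-i₀)
      b₁₁≡b⁺i : proj₁ v₁₁ ≡ b⁺ i
      b₁₁≡b⁺i = proj₁ (step-values step-i across-i₁ (proj₂ v₁₁) (proj₂ v₀₁))
      b₁₀≡b⁺i : proj₁ v₁₀ ≡ b⁺ i
      b₁₀≡b⁺i = proj₁ (step-values step-i across-i₀ (proj₂ v₁₀) (proj₂ v₀₀))
      b₁₁≡b⁺j : proj₁ v₁₁ ≡ b⁺ j
      b₁₁≡b⁺j = proj₁ (step-values step-j across-j (proj₂ v₁₁) (proj₂ v₁₀))
      b₁₀≡b⁻j : proj₁ v₁₀ ≡ b⁻ j
      b₁₀≡b⁻j = proj₂ (step-values step-j across-j (proj₂ v₁₁) (proj₂ v₁₀))

    step⇒heaviside : ∀ i → b⁺ i ≢ b⁻ i → _≈V_ 𝕂 A R f (x 𝕂 A R (b⁺ i) i)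
    step⇒heaviside i step s ch = begin
      f s                             ≈⟨ f≈affine s ch ⟩
      affine c₀ cs s                  ≈⟨ affine-single c₀ cs i others s ⟩
      c₀ + cs i * ⟦ s i ⟧             ≈⟨ +-cong c₀≈ (*-congʳ csᵢ≈) ⟩
      ⟦ not σ ⟧ + signum σ * ⟦ s i ⟧  ≈⟨ heaviside-affine σ i s ⟨
      x 𝕂 A R σ i s                   ∎
      where
      σ : Bool
      σ = b⁺ i
      b⁻≡¬σ : b⁻ i ≡ not σ
      b⁻≡¬σ = ¬-not (step ∘ ≡.sym)
      others : ∀ j → j ≢ i → cs j ≈ 0#
      others j j≢i = level⇒cs≈0 j
        (decidable-stable (b⁺ j ≟B b⁻ j) (no-two-steps (square gen i j (j≢i ∘ ≡.sym)) step))
      vanishes-on-s⁻ : cs i * ⟦ s⁻ i i ⟧ ≈ 0#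
      vanishes-on-s⁻ =
        trans (*-congˡ (reflexive (≡.cong ⟦_⟧ (Adjacent.negative (pair i))))) (zeroʳ (cs i))
      c₀≈ : c₀ ≈ ⟦ not σ ⟧
      c₀≈ = begin
        c₀                      ≈⟨ +-identityʳ c₀ ⟨
        c₀ + 0#                 ≈⟨ +-congˡ vanishes-on-s⁻ ⟨
        c₀ + cs i * ⟦ s⁻ i i ⟧  ≈⟨ affine-single c₀ cs i others (s⁻ i) ⟨
        affine c₀ cs (s⁻ i)     ≈⟨ f≈affine (s⁻ i) (Adjacent.chamber′ (pair i)) ⟨
        f (s⁻ i)                ≈⟨ proj₂ (value⁻ i) ⟩
        ⟦ b⁻ i ⟧                ≡⟨ ≡.cong ⟦_⟧ b⁻≡¬σ ⟩
        ⟦ not σ ⟧               ∎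
      csᵢ≈ : cs i ≈ signum σ
      csᵢ≈ = +-cancelʳ ⟦ not σ ⟧ (cs i) (signum σ) (begin
        cs i + ⟦ not σ ⟧      ≡⟨ ≡.cong (λ b → cs i + ⟦ b ⟧) b⁻≡¬σ ⟨
        cs i + ⟦ b⁻ i ⟧       ≈⟨ crossing i ⟨
        ⟦ σ ⟧                 ≈⟨ ⟦⟧-signum σ ⟩
        signum σ + ⟦ not σ ⟧  ∎)

    level⇒constant : (∀ i → b⁺ i ≡ b⁻ i) → Σ Bool (λ b → _≈V_ 𝕂 A R f (λ _ → ⟦ b ⟧))
    level⇒constant level =
      let s₀ , ch₀ = some-chamber
          b , fs₀≈b = valued ch₀
      in b , λ s ch → begin
        f s              ≈⟨ f≈affine s ch ⟩
        affine c₀ cs s   ≈⟨ affine≈c₀ s ⟩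
        c₀               ≈⟨ affine≈c₀ s₀ ⟨
        affine c₀ cs s₀  ≈⟨ f≈affine s₀ ch₀ ⟨
        f s₀             ≈⟨ fs₀≈b ⟩
        ⟦ b ⟧            ∎
      where
      affine≈c₀ : ∀ s → affine c₀ cs s ≈ c₀
      affine≈c₀ s = trans (+-congˡ (sumFin-zero n terms≈0)) (+-identityʳ c₀)
        where
        terms≈0 : ∀ j → cs j * ⟦ s j ⟧ ≈ 0#
        terms≈0 j = trans (*-congʳ (level⇒cs≈0 j (level j))) (zeroˡ _)

    recognise : ¬ (_≈V_ 𝕂 A R f (0V 𝕂 A R)) → ¬ (_≈V_ 𝕂 A R f (1V 𝕂 A R)) → InHeav 𝕂 A R f
    recognise f≉0 f≉1 = decide (all? (λ i → b⁺ i ≟B b⁻ i))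
      where
      excluded : Σ Bool (λ b → _≈V_ 𝕂 A R f (λ _ → ⟦ b ⟧)) → InHeav 𝕂 A R f
      excluded (false , f≈0) = contradiction f≈0 f≉0
      excluded (true  , f≈1) = contradiction f≈1 f≉1
      decide : Dec (∀ i → b⁺ i ≡ b⁻ i) → InHeav 𝕂 A R f
      decide (yes level) = excluded (level⇒constant level)
      decide (no ¬level) =
        let i , step = ¬∀⟶∃¬ n _ (λ i → b⁺ i ≟B b⁻ i) ¬level in b⁺ i , i , step⇒heaviside i step

lemma3p8 : {c ℓ₁ ℓ₂ r ℓr : Level} (𝕂 : RealField c ℓ₁ ℓ₂) (R : CommutativeRing r ℓr) →
    IsIntegralDomain R → CharNot2 R →
    (A : Arrangement 𝕂) → GenericCodim2 𝕂 A →
    (f : VG 𝕂 A R) →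
    InHeav 𝕂 A R f ⇔
      (InFil1 𝕂 A R f × IsIdem 𝕂 A R f × ¬ (_≈V_ 𝕂 A R f (0V 𝕂 A R)) × ¬ (_≈V_ 𝕂 A R f (1V 𝕂 A R)))
lemma3p8 𝕂 R domain 2≉0 A gen f = mk⇔ (heaviside⇒ (proj₁ domain)) recognise′
  where
  open Heaviside 𝕂 A R
  recognise′ : InFil1 𝕂 A R f × IsIdem 𝕂 A R f ×
               ¬ (_≈V_ 𝕂 A R f (0V 𝕂 A R)) × ¬ (_≈V_ 𝕂 A R f (1V 𝕂 A R)) → InHeav 𝕂 A R f
  recognise′ ((c₀ , cs , f≈affine) , idempotent , f≉0 , f≉1) =
    Recognise.recognise domain 2≉0 gen f≈affine idempotent f≉0 f≉1
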